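{- Let $x''$ be the integral assignment obtained from an integral feasible flow of value $|P|$ in the flow network described in the context. Then for each center $i\in\mathcal{C}_{\mathrm{DS}}$ and each color $h\in H$, \[\ell_h\sum_{j\in P}x''_{ij}-2\le\sum_{j\in P_h}x''_{ij}\le u_h\sum_{j\in P}x''_{ij}+2.\]
   Context: Let $P$ be a finite point set partitioned into color classes $P=P_1\,\dot\cup\dots\dot\cup\,P_m$, $H=\{1,\dots,m\}$, with bounds $0\le\ell_h\le u_h\le1$, and let $\mathcal{C}_{\mathrm{DS}}\subseteq P$. Let $x'=(x'_{ij})_{i,j\in P}$ be a fractional assignment with $x'_{ij}\ge0$, $\sum_{i}x'_{ij}=1$ for every $j$, $x'_{ij}=0$ for $i\notin\mathcal{C}_{\mathrm{DS}}$, and satisfying $\ell_h\sum_{j\in P}x'_{ij}\le\sum_{j\in P_h}x'_{ij}\le u_h\sum_{j\in P}x'_{ij}$ for all $h,i$. Flow network: vertices $s,t$, one vertex per $j\in P$, one per pair $(i,h)\in\mathcal{C}_{\mathrm{DS}}\times H$, one per $i\in\mathcal{C}_{\mathrm{DS}}$. Edges: $(s,j)$ for $j\in P$ with capacity $1$; $(j,(i,h))$ for $i\in\mathcal{C}_{\mathrm{DS}}$, $j\in P_h$ with $x'_{ij}>0$, capacity $1$; $((i,h),i)$ with lower bound $\lfloor\sum_{j\in P_h}x'_{ij}\rfloor$ and upper bound $\lceil\sum_{j\in P_h}x'_{ij}\rceil$; $(i,t)$ with lower bound $\lfloor\sum_{j\in P}x'_{ij}\rfloor$ and upper bound $\lceil\sum_{j\in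 P}x'_{ij}\rceil$. For an integral flow $f$ of value $|P|$, the assignment is $x''_{ij}=1$ if $f$ sends one unit on the edge $(j,(i,h))$ with $j\in P_h$, and $x''_{ij}=0$ otherwise. -}

module Defs where

open import Data.Nat as ℕ using (ℕ; zero; suc)
open import Data.Fin using (Fin; zero; suc; _≟_)
open import Data.Integer as ℤ using (ℤ; +_)
open import Data.Rational using (ℚ; 0ℚ; 1ℚ; _+_; _*_; _-_; _/_; _≤_; _<_; floor; ceiling)
open import Data.Product using (_×_)
open import Relation.Binary.PropositionalEquality using (_≡_)
open import Relation.Nullary using (¬_; yes; no)

Σℚ : ∀ {n} → (Fin n → ℚ) → ℚ
Σℚ {zero}  f = 0ℚ
Σℚ {suc n} f = f zero + Σℚ (λ k → f (suc k))

Σℕ : ∀ {n} → (Fin n → ℕ) → ℕ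
Σℕ {zero}  f = 0
Σℕ {suc n} f = f zero ℕ.+ Σℕ (λ k → f (suc k))

ℕtoℚ : ℕ → ℚ
ℕtoℚ k = + k / 1

-- restriction of a summand to the colour class P_h
-- (points are Fin n, col j is the colour of point j, colours are Fin m)
onClassℚ : ∀ {n m} → (Fin n → Fin m) → Fin m → (Fin n → ℚ) → Fin n → ℚ
onClassℚ col h f j with col j ≟ h
... | yes _ = f j
... | no  _ = 0ℚ

onClassℕ : ∀ {n m} → (Fin n → Fin m) → Fin m → (Fin n → ℕ) → Fin n → ℕ
onClassℕ col h f j with col j ≟ h
... | yes _ = f j
... | no  _ = 0

-- The data of the fair-assignment LP solution x' (indexed x' i j : center i, point j).
record FracAssignment (n m : ℕ) (col : Fin n → Fin m) (ℓ u : Fin m → ℚ)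
                      (C : Fin n → Set) : Set₁ where
  field
    x'        : Fin n → Fin n → ℚ
    nonneg    : ∀ i j → 0ℚ ≤ x' i j
    colSum    : ∀ j → Σℚ (λ i → x' i j) ≡ 1ℚ
    outsideC  : ∀ i j → ¬ C i → x' i j ≡ 0ℚ
    fairLow   : ∀ h i → ℓ h * Σℚ (x' i) ≤ Σℚ (onClassℚ col h (x' i))
    fairUp    : ∀ h i → Σℚ (onClassℚ col h (x' i)) ≤ u h * Σℚ (x' i)

-- Flows on edges:  s→j : fs j ;  j→(i,col j) : fp j i  (the only edges out of j
-- go to pair-vertices (i, h) with h = col j);  (i,h)→i : fh i h ;  i→t : ft i.
-- Edges that do not exist in the network carry flow 0.
record IntegralFlow (n m : ℕ) (col : Fin n → Fin m) (C : Fin n → Set)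
                    (x' : Fin n → Fin n → ℚ) : Set where
  field
    fs : Fin n → ℕ
    fp : Fin n → Fin n → ℕ
    fh : Fin n → Fin m → ℕ
    ft : Fin n → ℕ
    fs-cap  : ∀ j → fs j ℕ.≤ 1
    fp-cap  : ∀ j i → fp j i ℕ.≤ 1
    fp-edge : ∀ j i → ¬ (C i × (0ℚ < x' i j)) → fp j i ≡ 0
    fh-low  : ∀ i h → C i → floor (Σℚ (onClassℚ col h (x' i))) ℤ.≤ + fh i h
    fh-up   : ∀ i h → C i → + fh i h ℤ.≤ ceiling (Σℚ (onClassℚ col h (x' i)))
    fh-none : ∀ i h → ¬ C i → fh i h ≡ 0
    ft-low  : ∀ i → C i → floor (Σℚ (x' i)) ℤ.≤ + ft i
    ft-up   : ∀ i → C i → + ft i ℤ.≤ ceiling (Σℚ (x' i))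
    ft-none : ∀ i → ¬ C i → ft i ≡ 0
    cons-j  : ∀ j → fs j ≡ Σℕ (λ i → fp j i)
    cons-ih : ∀ i h → C i → Σℕ (onClassℕ col h (λ j → fp j i)) ≡ fh i h
    cons-i  : ∀ i → C i → Σℕ (fh i) ≡ ft i
    value   : Σℕ fs ≡ n

x'' : ∀ {n} → (Fin n → Fin n → ℕ) → Fin n → Fin n → ℚ
x'' fp i j with fp j i ℕ.≟ 1
... | yes _ = 1ℚ
... | no  _ = 0ℚ

-- Conservation at the vertices (i,h) and i identifies the number of points x'' assigns
-- to i, and those of colour h, with the flows fᵢₜ and f₍ᵢ,ₕ₎ᵢ.  The bounds of these two
-- edges put them within distance 1 of the fractional loads A = Σⱼ x'ᵢⱼ and B = Σ_{j∈Pₕ} x'ᵢⱼ,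
-- and ℓₕ A ≤ B ≤ uₕ A survives this perturbation with an additive loss of at most 2
-- because 0 ≤ ℓₕ ≤ uₕ ≤ 1.
module Submission where

open import Data.Nat as ℕ using (ℕ; zero; suc)
import Data.Nat.Properties as ℕP
import Data.Nat.Coprimality as Coprimality
open import Data.Fin using (Fin; zero; suc; _≟_)
open import Data.Fin.Properties using (suc-injective)
open import Data.Integer as ℤ using (ℤ; +_)
import Data.Integer.Properties as ℤP
import Data.Integer.DivMod as ℤD
open import Data.Rational
  using (ℚ; mkℚ; 0ℚ; 1ℚ; _+_; _*_; _-_; -_; _/_; _≤_; *≤*; floor; ceiling; nonNegative)
open import Data.Rational.Properties
  using (↥p/↧p≡p; ≤-trans; neg-antimono-≤; +-monoˡ-≤; +-monoʳ-≤; *-monoˡ-≤-nonNeg; module ≤-Reasoning)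
open import Data.Rational.Solver using (module +-*-Solver)
open import Data.Product using (_×_; _,_)
open import Data.Sum using (inj₁; inj₂)
open import Data.Empty using (⊥-elim)
open import Function using (_∘_)
open import Relation.Binary.PropositionalEquality
open import Relation.Nullary using (¬_; yes; no)
open import Algebra.Properties.CommutativeMonoid.Sum ℕP.+-0-commutativeMonoid
  using (sum; sum-cong-≗; ∑-comm; sum-replicate-zero)

open import Defs

Σℕ≡sum : ∀ {n} (f : Fin n → ℕ) → Σℕ f ≡ sum f
Σℕ≡sum {zero}  f = refl
Σℕ≡sum {suc n} f = cong (f zero ℕ.+_) (Σℕ≡sum (f ∘ suc))

Σℕ-cong : ∀ {n} {f g : Fin n → ℕ} → (∀ k → f k ≡ g k) → Σℕ f ≡ Σℕ g
Σℕ-cong {zero}  f≗g = refl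
Σℕ-cong {suc n} f≗g = cong₂ ℕ._+_ (f≗g zero) (Σℕ-cong (f≗g ∘ suc))

Σℚ-cong : ∀ {n} {f g : Fin n → ℚ} → (∀ k → f k ≡ g k) → Σℚ f ≡ Σℚ g
Σℚ-cong {zero}  f≗g = refl
Σℚ-cong {suc n} f≗g = cong₂ _+_ (f≗g zero) (Σℚ-cong (f≗g ∘ suc))

Σℕ-comm : ∀ {m n} (F : Fin m → Fin n → ℕ) →
          Σℕ (λ h → Σℕ (F h)) ≡ Σℕ (λ j → Σℕ (λ h → F h j))
Σℕ-comm F = begin
  Σℕ (λ h → Σℕ (F h))           ≡⟨ Σℕ≡sum (λ h → Σℕ (F h)) ⟩
  sum (λ h → Σℕ (F h))          ≡⟨ sum-cong-≗ (λ h → Σℕ≡sum (F h)) ⟩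
  sum (λ h → sum (F h))         ≡⟨ ∑-comm F ⟩
  sum (λ j → sum (λ h → F h j)) ≡⟨ sum-cong-≗ (λ j → Σℕ≡sum (λ h → F h j)) ⟨
  sum (λ j → Σℕ (λ h → F h j))  ≡⟨ Σℕ≡sum (λ j → Σℕ (λ h → F h j)) ⟨
  Σℕ (λ j → Σℕ (λ h → F h j))   ∎
  where open ≡-Reasoning

Σℕ-supported : ∀ {m} {g : Fin m → ℕ} c → (∀ h → ¬ h ≡ c → g h ≡ 0) → Σℕ g ≡ g c
Σℕ-supported {suc m} {g} zero vanish = begin
  g zero ℕ.+ Σℕ (g ∘ suc)       ≡⟨ cong (g zero ℕ.+_) (Σℕ-cong λ k → vanish (suc k) λ ()) ⟩
  g zero ℕ.+ Σℕ {m} (λ _ → 0)   ≡⟨ cong (g zero ℕ.+_) (trans (Σℕ≡sum (λ (_ : Fin m) → 0)) (sum-replicate-zero m)) ⟩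
  g zero ℕ.+ 0                  ≡⟨ ℕP.+-identityʳ (g zero) ⟩
  g zero                        ∎
  where open ≡-Reasoning
Σℕ-supported {suc m} {g} (suc c) vanish =
  cong₂ ℕ._+_ (vanish zero λ ()) (Σℕ-supported c λ h h≢c → vanish (suc h) (h≢c ∘ suc-injective))

module _ {n m} (col : Fin n → Fin m) where

  onClassℕ-own : ∀ (g : Fin n → ℕ) j → onClassℕ col (col j) g j ≡ g j
  onClassℕ-own g j with col j ≟ col j
  ... | yes _   = refl
  ... | no  c≢c = ⊥-elim (c≢c refl)

  onClassℕ-other : ∀ (g : Fin n → ℕ) h j → ¬ h ≡ col j → onClassℕ col h g j ≡ 0
  onClassℕ-other g h j h≢c with col j ≟ h
  ... | yes c≡h = ⊥-elim (h≢c (sym c≡h))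
  ... | no  _   = refl

  Σℕ-onClassℕ : ∀ (g : Fin n → ℕ) → Σℕ (λ h → Σℕ (onClassℕ col h g)) ≡ Σℕ g
  Σℕ-onClassℕ g = trans (Σℕ-comm (λ h → onClassℕ col h g)) (Σℕ-cong λ j →
    trans (Σℕ-supported (col j) (λ h → onClassℕ-other g h j)) (onClassℕ-own g j))

  onClassℚ-ℕtoℚ : ∀ {f : Fin n → ℚ} {g : Fin n → ℕ} h → (∀ j → f j ≡ ℕtoℚ (g j)) →
                  ∀ j → onClassℚ col h f j ≡ ℕtoℚ (onClassℕ col h g j)
  onClassℚ-ℕtoℚ h f≗g j with col j ≟ h
  ... | yes _ = f≗g j
  ... | no  _ = refl

mkℚ/1 : ℤ → ℚ
mkℚ/1 i = mkℚ i 0 (Coprimality.sym (Coprimality.1-coprimeTo ℤ.∣ i ∣))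

/1≡mkℚ/1 : ∀ i → i / 1 ≡ mkℚ/1 i
/1≡mkℚ/1 i = ↥p/↧p≡p (mkℚ/1 i)

/1-homo-+ : ∀ i j → (i ℤ.+ j) / 1 ≡ i / 1 + j / 1
/1-homo-+ i j = begin
  (i ℤ.+ j) / 1                  ≡⟨ cong₂ (λ a b → (a ℤ.+ b) / 1) (ℤP.*-identityʳ i) (ℤP.*-identityʳ j) ⟨
  (i ℤ.* + 1 ℤ.+ j ℤ.* + 1) / 1  ≡⟨ cong₂ _+_ (/1≡mkℚ/1 i) (/1≡mkℚ/1 j) ⟨
  i / 1 + j / 1                  ∎
  where open ≡-Reasoning

/1-homo-neg : ∀ i → (ℤ.- i) / 1 ≡ - (i / 1)
/1-homo-neg i = trans (/1≡mkℚ/1 (ℤ.- i)) (sym (trans (cong -_ (/1≡mkℚ/1 i)) (neg-mkℚ i)))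
  where
  neg-mkℚ : ∀ i → - mkℚ/1 i ≡ mkℚ/1 (ℤ.- i)
  neg-mkℚ (+ zero)   = refl
  neg-mkℚ ℤ.+[1+ _ ] = refl
  neg-mkℚ ℤ.-[1+ _ ] = refl

ℕtoℚ-homo-+ : ∀ a b → ℕtoℚ (a ℕ.+ b) ≡ ℕtoℚ a + ℕtoℚ b
ℕtoℚ-homo-+ a b = /1-homo-+ (+ a) (+ b)

Σℚ-ℕtoℚ : ∀ {n} (g : Fin n → ℕ) → Σℚ (ℕtoℚ ∘ g) ≡ ℕtoℚ (Σℕ g)
Σℚ-ℕtoℚ {zero}  g = refl
Σℚ-ℕtoℚ {suc n} g =
  trans (cong (λ s → ℕtoℚ (g zero) + s) (Σℚ-ℕtoℚ (g ∘ suc))) (sym (ℕtoℚ-homo-+ (g zero) (Σℕ (g ∘ suc))))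

⌊p⌋≤i⇒p≤i+1 : ∀ p i → floor p ℤ.≤ i → p ≤ i / 1 + 1ℚ
⌊p⌋≤i⇒p≤i+1 p@(mkℚ a d-1 _) i ⌊p⌋≤i =
  subst (p ≤_) (trans (sym (/1≡mkℚ/1 (i ℤ.+ + 1))) (/1-homo-+ i (+ 1))) (*≤* (begin
    a ℤ.* + 1                 ≡⟨ ℤP.*-identityʳ a ⟩
    a                         <⟨ ℤD.n<s[n/ℕd]*d a d ⟩
    ℤ.suc (a ℤ./ℕ d) ℤ.* + d  ≤⟨ ℤP.*-monoʳ-≤-nonNeg (+ d) (ℤP.+-monoʳ-≤ (+ 1) a/d≤i) ⟩
    (+ 1 ℤ.+ i) ℤ.* + d       ≡⟨ cong (ℤ._* + d) (ℤP.+-comm (+ 1) i) ⟩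
    (i ℤ.+ + 1) ℤ.* + d       ∎))
  where
  open ℤP.≤-Reasoning
  d : ℕ
  d = suc d-1
  a/d≤i : a ℤ./ℕ d ℤ.≤ i
  a/d≤i = subst (ℤ._≤ i) (ℤD.div-pos-is-/ℕ a d) ⌊p⌋≤i

i≤⌈p⌉⇒i-1≤p : ∀ p i → i ℤ.≤ ceiling p → i / 1 - 1ℚ ≤ p
i≤⌈p⌉⇒i-1≤p p@record{} i i≤⌈p⌉ =
  subst₂ _≤_ (-[-q+1]≡q-1 (i / 1)) (solve 1 (λ q → :- (:- q) := q) refl p) (neg-antimono-≤ (subst (- p ≤_) (cong (_+ 1ℚ) (/1-homo-neg i))
    (⌊p⌋≤i⇒p≤i+1 (- p) (ℤ.- i) (subst (ℤ._≤ ℤ.- i) (ℤP.neg-involutive _) (ℤP.neg-mono-≤ i≤⌈p⌉)))))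
  where
  open +-*-Solver
  -[-q+1]≡q-1 : ∀ q → - (- q + 1ℚ) ≡ q - 1ℚ
  -[-q+1]≡q-1 = solve 1 (λ q → :- (:- q :+ con 1ℚ) := q :- con 1ℚ) refl

module _ where
  open ≤-Reasoning
  open +-*-Solver

  fair-upper-rounded : ∀ {u A B F T} → 0ℚ ≤ u → u ≤ 1ℚ →
                       B ≤ u * A → F - 1ℚ ≤ B → A ≤ T + 1ℚ → F ≤ u * T + ℕtoℚ 2
  fair-upper-rounded {u} {A} {B} {F} {T} 0≤u u≤1 B≤uA F-1≤B A≤T+1 = begin
    F                   ≡⟨ solve 1 (λ f → f := (f :- con 1ℚ) :+ con 1ℚ) refl F ⟩
    (F - 1ℚ) + 1ℚ       ≤⟨ +-monoˡ-≤ 1ℚ (≤-trans F-1≤B B≤uA) ⟩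
    u * A + 1ℚ          ≤⟨ +-monoˡ-≤ 1ℚ (*-monoˡ-≤-nonNeg u A≤T+1) ⟩
    u * (T + 1ℚ) + 1ℚ   ≡⟨ solve 2 (λ u t → u :* (t :+ con 1ℚ) :+ con 1ℚ := u :* t :+ (u :+ con 1ℚ)) refl u T ⟩
    u * T + (u + 1ℚ)    ≤⟨ +-monoʳ-≤ (u * T) (+-monoˡ-≤ 1ℚ u≤1) ⟩
    u * T + ℕtoℚ 2      ∎
    where instance _ = nonNegative 0≤u

  fair-lower-rounded : ∀ {ℓ A B F T} → 0ℚ ≤ ℓ → ℓ ≤ 1ℚ →
                       ℓ * A ≤ B → B ≤ F + 1ℚ → T - 1ℚ ≤ A → ℓ * T - ℕtoℚ 2 ≤ F
  fair-lower-rounded {ℓ} {A} {B} {F} {T} 0≤ℓ ℓ≤1 ℓA≤B B≤F+1 T-1≤A = begin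
    ℓ * T - ℕtoℚ 2          ≡⟨ solve 2 (λ l t → l :* t :- con (ℕtoℚ 2) := l :* (t :- con 1ℚ) :+ (l :- con (ℕtoℚ 2))) refl ℓ T ⟩
    ℓ * (T - 1ℚ) + (ℓ - ℕtoℚ 2) ≤⟨ +-monoˡ-≤ (ℓ - ℕtoℚ 2) (*-monoˡ-≤-nonNeg ℓ T-1≤A) ⟩
    ℓ * A + (ℓ - ℕtoℚ 2)    ≤⟨ +-monoʳ-≤ (ℓ * A) (+-monoˡ-≤ (- ℕtoℚ 2) ℓ≤1) ⟩
    ℓ * A + (1ℚ - ℕtoℚ 2)   ≡⟨⟩
    ℓ * A - 1ℚ              ≤⟨ +-monoˡ-≤ (- 1ℚ) (≤-trans ℓA≤B B≤F+1) ⟩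
    F + 1ℚ - 1ℚ             ≡⟨ solve 1 (λ f → f :+ con 1ℚ :- con 1ℚ := f) refl F ⟩
    F                       ∎
    where instance _ = nonNegative 0≤ℓ

module _ {n} (fp : Fin n → Fin n → ℕ) (i j : Fin n) where

  x''-one : fp j i ≡ 1 → x'' fp i j ≡ 1ℚ
  x''-one fp≡1 with fp j i ℕ.≟ 1
  ... | yes _    = refl
  ... | no  fp≢1 = ⊥-elim (fp≢1 fp≡1)

  x''-zero : fp j i ≡ 0 → x'' fp i j ≡ 0ℚ
  x''-zero fp≡0 with fp j i ℕ.≟ 1
  ... | yes fp≡1 = ⊥-elim (ℕP.0≢1+n (trans (sym fp≡0) fp≡1))
  ... | no  _    = refl

  x''≡ℕtoℚ : fp j i ℕ.≤ 1 → x'' fp i j ≡ ℕtoℚ (fp j i)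
  x''≡ℕtoℚ fp≤1 with ℕP.n≤1⇒n≡0∨n≡1 fp≤1
  ... | inj₁ fp≡0 = trans (x''-zero fp≡0) (cong ℕtoℚ (sym fp≡0))
  ... | inj₂ fp≡1 = trans (x''-one fp≡1) (cong ℕtoℚ (sym fp≡1))

module _ {n m col C x'} (f : IntegralFlow n m col C x') where
  open IntegralFlow f

  Σ-onClass-x''≡fh : ∀ i h → C i → Σℚ (onClassℚ col h (x'' fp i)) ≡ ℕtoℚ (fh i h)
  Σ-onClass-x''≡fh i h Cᵢ = begin
    Σℚ (onClassℚ col h (x'' fp i))                   ≡⟨ Σℚ-cong (onClassℚ-ℕtoℚ col h λ j → x''≡ℕtoℚ fp i j (fp-cap j i)) ⟩
    Σℚ (ℕtoℚ ∘ onClassℕ col h (λ j → fp j i))        ≡⟨ Σℚ-ℕtoℚ (onClassℕ col h (λ j → fp j i)) ⟩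
    ℕtoℚ (Σℕ (onClassℕ col h (λ j → fp j i)))        ≡⟨ cong ℕtoℚ (cons-ih i h Cᵢ) ⟩
    ℕtoℚ (fh i h)                                    ∎
    where open ≡-Reasoning

  Σx''≡ft : ∀ i → C i → Σℚ (x'' fp i) ≡ ℕtoℚ (ft i)
  Σx''≡ft i Cᵢ = begin
    Σℚ (x'' fp i)                                        ≡⟨ Σℚ-cong (λ j → x''≡ℕtoℚ fp i j (fp-cap j i)) ⟩
    Σℚ (λ j → ℕtoℚ (fp j i))                             ≡⟨ Σℚ-ℕtoℚ (λ j → fp j i) ⟩
    ℕtoℚ (Σℕ (λ j → fp j i))                             ≡⟨ cong ℕtoℚ (Σℕ-onClassℕ col _) ⟨
    ℕtoℚ (Σℕ (λ h → Σℕ (onClassℕ col h (λ j → fp j i)))) ≡⟨ cong ℕtoℚ (Σℕ-cong λ h → cons-ih i h Cᵢ) ⟩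
    ℕtoℚ (Σℕ (fh i))                                     ≡⟨ cong ℕtoℚ (cons-i i Cᵢ) ⟩
    ℕtoℚ (ft i)                                          ∎
    where open ≡-Reasoning

lemma11 : (n m : ℕ) (col : Fin n → Fin m) (ℓ u : Fin m → ℚ)
          (bounds : (h : Fin m) → (0ℚ ≤ ℓ h) × (ℓ h ≤ u h) × (u h ≤ 1ℚ))
          (C : Fin n → Set)
          (X : FracAssignment n m col ℓ u C)
          (f : IntegralFlow n m col C (FracAssignment.x' X)) →
          (i : Fin n) → C i → (h : Fin m) →
          ((ℓ h * Σℚ (x'' (IntegralFlow.fp f) i) - ℕtoℚ 2)
             ≤ Σℚ (onClassℚ col h (x'' (IntegralFlow.fp f) i)))
          × (Σℚ (onClassℚ col h (x'' (IntegralFlow.fp f) i))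
             ≤ (u h * Σℚ (x'' (IntegralFlow.fp f) i) + ℕtoℚ 2))
lemma11 n m col ℓ u bounds C X f i Cᵢ h with bounds h
... | 0≤ℓ , ℓ≤u , u≤1 rewrite Σx''≡ft f i Cᵢ | Σ-onClass-x''≡fh f i h Cᵢ =
    fair-lower-rounded 0≤ℓ (≤-trans ℓ≤u u≤1) (fairLow h i)
      (⌊p⌋≤i⇒p≤i+1 _ _ (fh-low i h Cᵢ)) (i≤⌈p⌉⇒i-1≤p _ _ (ft-up i Cᵢ))
  , fair-upper-rounded (≤-trans 0≤ℓ ℓ≤u) u≤1 (fairUp h i)
      (i≤⌈p⌉⇒i-1≤p _ _ (fh-up i h Cᵢ)) (⌊p⌋≤i⇒p≤i+1 _ _ (ft-low i Cᵢ))
  where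
  open FracAssignment X
  open IntegralFlow f
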